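{- For each integer $k\ge1$, let $T_k(x)=\sum_{n\ge1}t_k(n)x^n$, where $t_k(n)$ is the total number of vertices having exactly $k$ vertices in their subtree, summed over all Schroeder trees with $n$ leaves. Let $R_k(x)=\sum_{n\ge1}r_k(n)x^n$, where $r_k(n)$ is the number of Schroeder trees with $n$ leaves and exactly $k$ vertices. Then, as formal power series, $$T_k(x)=\frac{R_k(x)\left(3-x+\sqrt{1-6x+x^2}\right)}{4\sqrt{1-6x+x^2}}.$$
   Context: A Schroeder tree is a rooted planar (ordered) tree in which every non-leaf vertex has at least two children; its size is its number of leaves. The subtree of a vertex $v$ consists of $v$ together with all of its descendants. The square root denotes the formal power series with constant term $1$. -}

module Defs where

open import Data.Nat using (ℕ; zero; suc; _≟_) renaming (_+_ to _+ℕ_)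
open import Data.Integer using (ℤ; +_; _+_; _*_; _-_)
open import Data.List using (List; []; _∷_; map)
open import Data.Nat.ListAction using (sum)
open import Relation.Nullary.Decidable using (does)
open import Data.Bool using (if_then_else_)

-- A node is given by its first child,
-- its second child, and the (possibly empty) list of further children.

data Tree : Set where
  leaf : Tree
  node : Tree → Tree → List Tree → Tree

mutual
  leaves : Tree → ℕ
  leaves leaf = 1
  leaves (node a b cs) = leaves a +ℕ (leaves b +ℕ leavesL cs)

  leavesL : List Tree → ℕ
  leavesL [] = 0
  leavesL (c ∷ cs) = leaves c +ℕ leavesL cs

mutual
  vertices : Tree → ℕ
  vertices leaf = 1
  vertices (node a b cs) = suc (vertices a +ℕ (vertices b +ℕ verticesL cs))

  verticesL : List Tree → ℕ
  verticesL [] = 0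
  verticesL (c ∷ cs) = vertices c +ℕ verticesL cs

ind : ℕ → ℕ → ℕ
ind m k = if does (m ≟ k) then 1 else 0

mutual
  subCount : ℕ → Tree → ℕ
  subCount k leaf = ind 1 k
  subCount k t@(node a b cs) =
    ind (vertices t) k +ℕ (subCount k a +ℕ (subCount k b +ℕ subCountL k cs))

  subCountL : ℕ → List Tree → ℕ
  subCountL k [] = 0
  subCountL k (c ∷ cs) = subCount k c +ℕ subCountL k cs

Series : Set
Series = ℕ → ℤ

convSum : (ℕ → ℕ → ℤ) → ℕ → ℤ
convSum f zero = f 0 0
convSum f (suc n) = f 0 (suc n) + convSum (λ i j → f (suc i) j) n

_⋆_ : Series → Series → Series
(f ⋆ g) n = convSum (λ i j → f i * g j) n

_⊕_ : Series → Series → Series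
(f ⊕ g) n = f n + g n

_·_ : ℤ → Series → Series
(c · f) n = c * f n

P : Series
P 0 = + 1
P 1 = Data.Integer.- (+ 6)
P 2 = + 1
P (suc (suc (suc _))) = + 0

threeMinusX : Series
threeMinusX 0 = + 3
threeMinusX 1 = Data.Integer.- (+ 1)
threeMinusX (suc (suc _)) = + 0

-- Given a list enumerating the Schroeder trees with n leaves (for each n):

T : (ℕ → List Tree) → ℕ → Series
T enum k n = + sum (map (subCount k) (enum n))

R : (ℕ → List Tree) → ℕ → Series
R enum k n = + sum (map (λ t → ind (vertices t) k) (enum n))

{-# OPTIONS --safe #-}
-- Let F and L count Schröder trees and forests (finite lists of trees) by leaves, and let M
-- count, over all forests, the vertices whose subtree has k vertices. Splitting a forest at its
-- first tree and a tree at its root (a leaf, or a node with children a, b and the list cs) gives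
--   L = 1 + F L,   F = x + F² L,   M = T L + F M,   T = R + T F L + F (T L + F M),
-- where R accounts for the roots. Hence L (1 − F) = 1 and F² = (F − x)(1 − F), so U = 1 + x − 4F
-- satisfies U² = 1 − 6x + x²; since S and U both have constant term 1, S = U. Multiplying the
-- equation for T by (1 − F)² and eliminating L and M gives T U = R (1 − F), that is,
-- 4 S T = R (3 − x + S).
module Submission where

open import Defs
open import Data.Nat as ℕ using (ℕ; zero; suc; _≤_; _<_)
import Data.Nat.Properties as ℕₚ
open import Data.Nat.Induction using (<-rec)
open import Data.Nat.ListAction using (sum)
open import Data.Nat.ListAction.Properties using (sum-++; sum-↭)
open import Data.Integer as ℤ using (ℤ; +_; _+_; _*_; -_; 0ℤ; 1ℤ)
import Data.Integer.Properties as ℤ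
open import Data.Empty using (⊥)
open import Data.Maybe using (Maybe; just; nothing)
open import Data.Product using (_×_; _,_; proj₁; proj₂; ∃-syntax; uncurry)
open import Data.Sum using (_⊎_; inj₁; inj₂; [_,_])
open import Data.List using (List; []; _∷_; _++_; map; cartesianProduct)
open import Data.List.Properties using (map-++; map-∘; map-cong)
open import Data.List.Membership.Propositional using (_∈_)
open import Data.List.Membership.Propositional.Properties
  using (∈-++⁻; ∈-++⁺ˡ; ∈-++⁺ʳ; ∈-map⁻; ∈-map⁺; ∈-cartesianProduct⁻; ∈-cartesianProduct⁺)
open import Data.List.Membership.Propositional.Properties.WithK using (unique∧set⇒bag)
open import Data.List.Relation.Binary.BagAndSetEquality using (∼bag⇒↭)
import Data.List.Relation.Binary.Permutation.Propositional.Properties as ↭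
open import Data.List.Relation.Unary.All using ([])
import Data.List.Relation.Unary.AllPairs as AllPairs
open import Data.List.Relation.Unary.Any using (here; there)
open import Data.List.Relation.Unary.Unique.Propositional using (Unique)
import Data.List.Relation.Unary.Unique.Propositional.Properties as Unique
open import Function.Base using (const; _∘′_)
open import Function.Bundles using (_⇔_; mk⇔; Equivalence)
open import Function.Definitions using (Injective)
import Function.Properties.Equivalence as ⇔
open import Relation.Nullary using (yes; no; contradiction)
open import Relation.Binary.PropositionalEquality
  using (_≡_; _≢_; refl; sym; trans; cong; cong₂; subst; module ≡-Reasoning)
import Relation.Binary.Reasoning.Setoid
open import Algebra.Bundles using (CommutativeRing)
open import Algebra.Structures using (IsCommutativeRing)
import Algebra.Construct.Pointwise as Pointwise
import Algebra.Properties.CommutativeSemigroup as CommutativeSemigroupProperties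
open import Algebra.Solver.Ring.AlmostCommutativeRing
  using (fromCommutativeRing; _-Raw-AlmostCommutative⟶_)

module ℤ+ = CommutativeSemigroupProperties ℤ.+-commutativeSemigroup
module ℕ+ = CommutativeSemigroupProperties ℕₚ.+-commutativeSemigroup

convSum-cong : ∀ {f g} → (∀ i j → f i j ≡ g i j) → ∀ n → convSum f n ≡ convSum g n
convSum-cong f≡g zero    = f≡g 0 0
convSum-cong f≡g (suc n) = cong₂ _+_ (f≡g 0 (suc n)) (convSum-cong (λ i → f≡g (suc i)) n)

convSum-+ : ∀ f g n → convSum (λ i j → f i j + g i j) n ≡ convSum f n + convSum g n
convSum-+ f g zero    = refl
convSum-+ f g (suc n) =
  trans (cong (_+_ (f 0 (suc n) + g 0 (suc n))) (convSum-+ (λ i → f (suc i)) (λ i → g (suc i)) n))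
        (ℤ+.interchange (f 0 (suc n)) (g 0 (suc n)) _ _)

convSum-*ˡ : ∀ c f n → convSum (λ i j → c * f i j) n ≡ c * convSum f n
convSum-*ˡ c f zero    = refl
convSum-*ˡ c f (suc n) =
  trans (cong (_+_ (c * f 0 (suc n))) (convSum-*ˡ c (λ i → f (suc i)) n))
        (sym (ℤ.*-distribˡ-+ c (f 0 (suc n)) _))

convSum-last : ∀ f n → convSum f (suc n) ≡ convSum (λ i j → f i (suc j)) n + f (suc n) 0
convSum-last f zero    = refl
convSum-last f (suc n) =
  trans (cong (_+_ (f 0 (suc (suc n)))) (convSum-last (λ i → f (suc i)) n))
        (sym (ℤ.+-assoc (f 0 (suc (suc n))) _ _))

convSum-swap : ∀ f n → convSum f n ≡ convSum (λ i j → f j i) n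
convSum-swap f zero    = refl
convSum-swap f (suc n) = begin
  f 0 (suc n) + convSum (λ i → f (suc i)) n     ≡⟨ cong (_+_ (f 0 (suc n))) (convSum-swap (λ i → f (suc i)) n) ⟩
  f 0 (suc n) + convSum (λ i j → f (suc j) i) n ≡⟨ ℤ.+-comm (f 0 (suc n)) _ ⟩
  convSum (λ i j → f (suc j) i) n + f 0 (suc n) ≡⟨ convSum-last (λ i j → f j i) n ⟨
  convSum (λ i j → f j i) (suc n)               ∎
  where open ≡-Reasoning

convSum-assoc : ∀ (h : ℕ → ℕ → ℕ → ℤ) n →
  convSum (λ m l → convSum (λ i j → h i j l) m) n ≡ convSum (λ i m → convSum (λ j l → h i j l) m) n
convSum-assoc h zero    = refl
convSum-assoc h (suc n) = begin
  h 0 0 (suc n) + convSum (λ m l → convSum (λ i j → h i j l) (suc m)) n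
    ≡⟨ cong (_+_ (h 0 0 (suc n))) (convSum-+ (λ m → h 0 (suc m)) (λ m l → convSum (λ i j → h (suc i) j l) m) n) ⟩
  h 0 0 (suc n) + (convSum (λ m → h 0 (suc m)) n + convSum (λ m l → convSum (λ i j → h (suc i) j l) m) n)
    ≡⟨ cong (λ z → h 0 0 (suc n) + (convSum (λ m → h 0 (suc m)) n + z)) (convSum-assoc (λ i → h (suc i)) n) ⟩
  h 0 0 (suc n) + (convSum (λ m → h 0 (suc m)) n + convSum (λ i m → convSum (λ j l → h (suc i) j l) m) n)
    ≡⟨ ℤ.+-assoc (h 0 0 (suc n)) _ _ ⟨
  convSum (λ m l → h 0 m l) (suc n) + convSum (λ i m → convSum (λ j l → h (suc i) j l) m) n
    ∎
  where open ≡-Reasoning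


-- The ring of formal power series

infix 4 _≈ₛ_
_≈ₛ_ : Series → Series → Set
f ≈ₛ g = ∀ n → f n ≡ g n

⊝_ : Series → Series
(⊝ f) n = - f n

constant : ℤ → Series
constant c zero    = c
constant c (suc _) = 0ℤ

0ₛ 1ₛ : Series
0ₛ = const 0ℤ
1ₛ = constant 1ℤ

constant-⋆ : ∀ c f → constant c ⋆ f ≈ₛ c · f
constant-⋆ c f zero    = refl
constant-⋆ c f (suc n) = begin
  c * f (suc n) + convSum (λ i j → 0ℤ * f j) n  ≡⟨ cong (_+_ (c * f (suc n))) higher-terms ⟩
  c * f (suc n) + 0ℤ                             ≡⟨ ℤ.+-identityʳ _ ⟩
  c * f (suc n)                                  ∎
  where
  open ≡-Reasoning
  higher-terms : convSum (λ i j → 0ℤ * f j) n ≡ 0ℤ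
  higher-terms = trans (convSum-*ˡ 0ℤ (λ _ → f) n) (ℤ.*-zeroˡ (convSum (λ _ → f) n))

⋆-cong : ∀ {f f′ g g′} → f ≈ₛ f′ → g ≈ₛ g′ → f ⋆ g ≈ₛ f′ ⋆ g′
⋆-cong f≈f′ g≈g′ = convSum-cong λ i j → cong₂ _*_ (f≈f′ i) (g≈g′ j)

⋆-comm : ∀ f g → f ⋆ g ≈ₛ g ⋆ f
⋆-comm f g n = trans (convSum-swap _ n) (convSum-cong (λ i j → ℤ.*-comm (f j) (g i)) n)

⋆-assoc : ∀ f g h → (f ⋆ g) ⋆ h ≈ₛ f ⋆ (g ⋆ h)
⋆-assoc f g h n = begin
  convSum (λ m l → convSum (λ i j → f i * g j) m * h l) n
    ≡⟨ convSum-cong (λ m l → trans (ℤ.*-comm _ (h l)) (sym (convSum-*ˡ (h l) _ m))) n ⟩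
  convSum (λ m l → convSum (λ i j → h l * (f i * g j)) m) n
    ≡⟨ convSum-assoc (λ i j l → h l * (f i * g j)) n ⟩
  convSum (λ i m → convSum (λ j l → h l * (f i * g j)) m) n
    ≡⟨ convSum-cong (λ i m → trans (convSum-cong (λ j l → reassociate (h l) (f i) (g j)) m)
                                    (convSum-*ˡ (f i) (λ j l → g j * h l) m)) n ⟩
  convSum (λ i m → f i * convSum (λ j l → g j * h l) m) n
    ∎
  where
  open ≡-Reasoning
  reassociate : ∀ a b c → a * (b * c) ≡ b * (c * a)
  reassociate a b c = trans (ℤ.*-comm a _) (ℤ.*-assoc b c a)

⋆-identityˡ : ∀ f → 1ₛ ⋆ f ≈ₛ f
⋆-identityˡ f n = trans (constant-⋆ 1ℤ f n) (ℤ.*-identityˡ (f n))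

⋆-distribʳ-⊕ : ∀ f g h → (g ⊕ h) ⋆ f ≈ₛ (g ⋆ f) ⊕ (h ⋆ f)
⋆-distribʳ-⊕ f g h n =
  trans (convSum-cong (λ i j → ℤ.*-distribʳ-+ (f j) (g i) (h i)) n) (convSum-+ _ _ n)

series-isCommutativeRing : IsCommutativeRing _≈ₛ_ _⊕_ _⋆_ ⊝_ 0ₛ 1ₛ
series-isCommutativeRing = record
  { isRing = record
    { +-isAbelianGroup = Pointwise.isAbelianGroup ℕ ℤ.+-0-isAbelianGroup
    ; *-cong           = ⋆-cong
    ; *-assoc          = ⋆-assoc
    ; *-identity       = ⋆-identityˡ , λ f n → trans (⋆-comm f 1ₛ n) (⋆-identityˡ f n)
    ; distrib          = (λ f g h n → trans (⋆-comm f (g ⊕ h) n)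
                                     (trans (⋆-distribʳ-⊕ f g h n)
                                            (cong₂ _+_ (⋆-comm g f n) (⋆-comm h f n))))
                       , ⋆-distribʳ-⊕
    }
  ; *-comm = ⋆-comm
  }

series-commutativeRing : CommutativeRing _ _
series-commutativeRing = record { isCommutativeRing = series-isCommutativeRing }

module 𝕊 = CommutativeRing series-commutativeRing
module ≈ₛ-Reasoning = Relation.Binary.Reasoning.Setoid 𝕊.setoid

constant-morphism : CommutativeRing.rawRing ℤ.+-*-commutativeRing
                      -Raw-AlmostCommutative⟶ fromCommutativeRing series-commutativeRing
constant-morphism = record
  { ⟦_⟧    = constant
  ; +-homo = λ { a b zero → refl ; a b (suc _) → refl }
  ; *-homo = λ { a b zero    → refl
             ; a b (suc n) → sym (trans (constant-⋆ a (constant b) (suc n)) (ℤ.*-zeroʳ a)) }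
  ; -‿homo = λ { a zero → refl ; a (suc _) → refl }
  ; 0-homo = λ { zero → refl ; (suc _) → refl }
  ; 1-homo = λ _ → refl
  }

constant-≟ : ∀ a b → Maybe (constant a ≈ₛ constant b)
constant-≟ a b with a ℤ.≟ b
... | yes refl = just λ _ → refl
... | no _     = nothing

open import Algebra.Solver.Ring (CommutativeRing.rawRing ℤ.+-*-commutativeRing)
  (fromCommutativeRing series-commutativeRing) constant-morphism constant-≟
  using (solve; _:=_; _:+_; _:*_; _:-_; con)

infixl 6 _⊖_
_⊖_ : Series → Series → Series
f ⊖ g = f ⊕ (⊝ g)


X : Series
X zero    = 0ℤ
X (suc n) = constant 1ℤ n

X-⋆ : ∀ f n → (X ⋆ f) (suc n) ≡ f n
X-⋆ f n = trans (ℤ.+-identityˡ ((1ₛ ⋆ f) n)) (⋆-identityˡ f n)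

P-expansion : (1ₛ ⊖ constant (+ 6) ⋆ X) ⊕ (X ⋆ X) ≈ₛ P
P-expansion 0                   = refl
P-expansion 1                   = refl
P-expansion 2                   = refl
P-expansion (suc (suc (suc n))) =
  cong₂ (λ a b → (0ℤ + - a) + b) (constant-⋆ (+ 6) X (3 ℕ.+ n)) (X-⋆ X (2 ℕ.+ n))

threeMinusX-expansion : threeMinusX ≈ₛ constant (+ 3) ⊖ X
threeMinusX-expansion 0             = refl
threeMinusX-expansion 1             = refl
threeMinusX-expansion (suc (suc n)) = refl

⋆-shiftˡ : ∀ f g n → f 0 ≡ 0ℤ → (f ⋆ g) (suc n) ≡ ((λ i → f (suc i)) ⋆ g) n
⋆-shiftˡ f g n f₀≡0 =
  trans (cong (λ f₀ → f₀ * g (suc n) + ((λ i → f (suc i)) ⋆ g) n) f₀≡0) (ℤ.+-identityˡ _)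

⋆-vanishing-below : ∀ D E n → (∀ {i} → i < n → D i ≡ 0ℤ) → (D ⋆ E) n ≡ D n * E 0
⋆-vanishing-below D E zero    _     = refl
⋆-vanishing-below D E (suc n) D<n≡0 = begin
  D 0 * E (suc n) + (D′ ⋆ E) n ≡⟨ cong₂ _+_ (cong (_* E (suc n)) (D<n≡0 (ℕ.s≤s ℕ.z≤n)))
                                             (⋆-vanishing-below D′ E n (λ i<n → D<n≡0 (ℕ.s≤s i<n))) ⟩
  0ℤ * E (suc n) + D′ n * E 0  ≡⟨ ℤ.+-identityˡ _ ⟩
  D (suc n) * E 0              ∎
  where
  open ≡-Reasoning
  D′ : Series
  D′ i = D (suc i)

⋆≈0ₛ⇒≈0ₛ : ∀ {D E} → E 0 ≢ 0ℤ → D ⋆ E ≈ₛ 0ₛ → D ≈ₛ 0ₛ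
⋆≈0ₛ⇒≈0ₛ {D} {E} E₀≢0 DE≈0 = <-rec (λ n → D n ≡ 0ℤ) vanishes
  where
  vanishes : ∀ n → (∀ {i} → i < n → D i ≡ 0ℤ) → D n ≡ 0ℤ
  vanishes n D<n≡0 with ℤ.i*j≡0⇒i≡0∨j≡0 (D n) (trans (sym (⋆-vanishing-below D E n D<n≡0)) (DE≈0 n))
  ... | inj₁ Dn≡0  = Dn≡0
  ... | inj₂ E₀≡0  = contradiction E₀≡0 E₀≢0

squareRoot-unique : ∀ {S U} → (S ⊕ U) 0 ≢ 0ℤ → S ⋆ S ≈ₛ U ⋆ U → S ≈ₛ U
squareRoot-unique {S} {U} S₀+U₀≢0 S²≈U² n = ℤ.i-j≡0⇒i≡j (S n) (U n) (⋆≈0ₛ⇒≈0ₛ {S ⊖ U} S₀+U₀≢0 (begin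
  (S ⊖ U) ⋆ (S ⊕ U)   ≈⟨ solve 2 (λ S U → (S :- U) :* (S :+ U) := S :* S :- U :* U) (λ _ → refl) S U ⟩
  S ⋆ S ⊖ U ⋆ U       ≈⟨ 𝕊.+-congʳ {⊝ (U ⋆ U)} S²≈U² ⟩
  U ⋆ U ⊖ U ⋆ U       ≈⟨ 𝕊.-‿inverseʳ (U ⋆ U) ⟩
  0ₛ                  ∎) n)
  where open ≈ₛ-Reasoning

⋆-cancelʳ-invertible : ∀ {a b u v} → v ⋆ u ≈ₛ 1ₛ → a ⋆ u ≈ₛ b ⋆ u → a ≈ₛ b
⋆-cancelʳ-invertible {a} {b} {u} {v} vu≈1 au≈bu = begin
  a              ≈⟨ 𝕊.*-identityʳ a ⟨
  a ⋆ 1ₛ         ≈⟨ 𝕊.*-congˡ {a} vu≈1 ⟨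
  a ⋆ (v ⋆ u)    ≈⟨ solve 3 (λ a u v → a :* (v :* u) := (a :* u) :* v) (λ _ → refl) a u v ⟩
  (a ⋆ u) ⋆ v    ≈⟨ 𝕊.*-congʳ {v} au≈bu ⟩
  (b ⋆ u) ⋆ v    ≈⟨ solve 3 (λ b u v → (b :* u) :* v := b :* (v :* u)) (λ _ → refl) b u v ⟩
  b ⋆ (v ⋆ u)    ≈⟨ 𝕊.*-congˡ {b} vu≈1 ⟩
  b ⋆ 1ₛ         ≈⟨ 𝕊.*-identityʳ b ⟩
  b              ∎
  where open ≈ₛ-Reasoning


-- Consequences of the functional equations

x≈y⊕Fx⇒x⋆[1⊖F]≈y : ∀ {F x y} → x ≈ₛ y ⊕ (F ⋆ x) → x ⋆ (1ₛ ⊖ F) ≈ₛ y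
x≈y⊕Fx⇒x⋆[1⊖F]≈y {F} {x} {y} x≈y+Fx = begin
  x ⋆ (1ₛ ⊖ F)          ≈⟨ solve 2 (λ F x → x :* (con 1ℤ :- F) := x :- F :* x) (λ _ → refl) F x ⟩
  x ⊖ F ⋆ x             ≈⟨ 𝕊.+-congʳ x≈y+Fx ⟩
  (y ⊕ (F ⋆ x)) ⊖ F ⋆ x ≈⟨ solve 3 (λ F x y → (y :+ F :* x) :- F :* x := y) (λ _ → refl) F x y ⟩
  y                     ∎
  where open ≈ₛ-Reasoning

tree-quadratic : ∀ {F L} → F ≈ₛ X ⊕ (F ⋆ (F ⋆ L)) → L ⋆ (1ₛ ⊖ F) ≈ₛ 1ₛ →
                 F ⋆ F ≈ₛ (F ⊖ X) ⋆ (1ₛ ⊖ F)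
tree-quadratic {F} {L} tree inverse = begin
  F ⋆ F                                  ≈⟨ 𝕊.*-identityʳ (F ⋆ F) ⟨
  (F ⋆ F) ⋆ 1ₛ                           ≈⟨ 𝕊.*-congˡ {F ⋆ F} inverse ⟨
  (F ⋆ F) ⋆ (L ⋆ (1ₛ ⊖ F))               ≈⟨ solve 3 (λ X F L → (F :* F) :* (L :* (con 1ℤ :- F))
                                                   := ((X :+ F :* (F :* L)) :- X) :* (con 1ℤ :- F))
                                                 (λ _ → refl) X F L ⟩
  ((X ⊕ (F ⋆ (F ⋆ L))) ⊖ X) ⋆ (1ₛ ⊖ F)  ≈⟨ 𝕊.*-congʳ {1ₛ ⊖ F} (𝕊.+-congʳ {⊝ X} tree) ⟨
  (F ⊖ X) ⋆ (1ₛ ⊖ F)                     ∎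
  where open ≈ₛ-Reasoning

discriminantRoot : Series → Series
discriminantRoot F = (1ₛ ⊕ X) ⊖ constant (+ 4) ⋆ F

discriminantRoot-square : ∀ {F} → F ⋆ F ≈ₛ (F ⊖ X) ⋆ (1ₛ ⊖ F) →
                          discriminantRoot F ⋆ discriminantRoot F ≈ₛ P
discriminantRoot-square {F} quadratic = begin
  discriminantRoot F ⋆ discriminantRoot F
    ≈⟨ solve 2 (λ X F → ((con 1ℤ :+ X) :- con (+ 4) :* F) :* ((con 1ℤ :+ X) :- con (+ 4) :* F)
                      := ((con 1ℤ :- con (+ 6) :* X) :+ X :* X)
                         :+ con (+ 8) :* (F :* F :- (F :- X) :* (con 1ℤ :- F)))
               (λ _ → refl) X F ⟩
  ((1ₛ ⊖ constant (+ 6) ⋆ X) ⊕ (X ⋆ X)) ⊕ (constant (+ 8) ⋆ (F ⋆ F ⊖ (F ⊖ X) ⋆ (1ₛ ⊖ F)))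
    ≈⟨ 𝕊.+-congˡ {(1ₛ ⊖ constant (+ 6) ⋆ X) ⊕ (X ⋆ X)}
                 (𝕊.*-congˡ {constant (+ 8)} (𝕊.+-congʳ {⊝ ((F ⊖ X) ⋆ (1ₛ ⊖ F))} quadratic)) ⟩
  ((1ₛ ⊖ constant (+ 6) ⋆ X) ⊕ (X ⋆ X)) ⊕ (constant (+ 8) ⋆ ((F ⊖ X) ⋆ (1ₛ ⊖ F) ⊖ (F ⊖ X) ⋆ (1ₛ ⊖ F)))
    ≈⟨ solve 2 (λ X F → ((con 1ℤ :- con (+ 6) :* X) :+ X :* X)
                         :+ con (+ 8) :* ((F :- X) :* (con 1ℤ :- F) :- (F :- X) :* (con 1ℤ :- F))
                      := (con 1ℤ :- con (+ 6) :* X) :+ X :* X)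
               (λ _ → refl) X F ⟩
  (1ₛ ⊖ constant (+ 6) ⋆ X) ⊕ (X ⋆ X)
    ≈⟨ P-expansion ⟩
  P ∎
  where open ≈ₛ-Reasoning

marked-tree-cleared : ∀ {F L M Tₖ Rₖ} → L ⋆ (1ₛ ⊖ F) ≈ₛ 1ₛ → M ⋆ (1ₛ ⊖ F) ≈ₛ Tₖ ⋆ L →
  Tₖ ≈ₛ Rₖ ⊕ ((Tₖ ⋆ (F ⋆ L)) ⊕ (F ⋆ ((Tₖ ⋆ L) ⊕ (F ⋆ M)))) →
  (Tₖ ⋆ (1ₛ ⊖ F)) ⋆ (1ₛ ⊖ F) ≈ₛ
    (((Rₖ ⋆ (1ₛ ⊖ F)) ⋆ (1ₛ ⊖ F)) ⊕ (constant (+ 2) ⋆ ((Tₖ ⋆ F) ⋆ (1ₛ ⊖ F)))) ⊕ ((F ⋆ F) ⋆ Tₖ)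
marked-tree-cleared {F} {L} {M} {Tₖ} {Rₖ} inverse marked-forest marked-tree = begin
  (Tₖ ⋆ G) ⋆ G
    ≈⟨ 𝕊.*-congʳ {G} (𝕊.*-congʳ {G} marked-tree) ⟩
  ((Rₖ ⊕ ((Tₖ ⋆ (F ⋆ L)) ⊕ (F ⋆ ((Tₖ ⋆ L) ⊕ (F ⋆ M))))) ⋆ G) ⋆ G
    ≈⟨ solve 5 (λ F L M Tₖ Rₖ → let G = con 1ℤ :- F in
                  ((Rₖ :+ ((Tₖ :* (F :* L)) :+ (F :* ((Tₖ :* L) :+ (F :* M))))) :* G) :* G
               := ((Rₖ :* G) :* G :+ (con (+ 2) :* ((Tₖ :* F) :* G)) :* (L :* G))
                  :+ ((F :* F) :* G) :* (M :* G))
               (λ _ → refl) F L M Tₖ Rₖ ⟩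
  (((Rₖ ⋆ G) ⋆ G) ⊕ ((constant (+ 2) ⋆ ((Tₖ ⋆ F) ⋆ G)) ⋆ (L ⋆ G))) ⊕ (((F ⋆ F) ⋆ G) ⋆ (M ⋆ G))
    ≈⟨ 𝕊.+-cong (𝕊.+-congˡ {(Rₖ ⋆ G) ⋆ G} (𝕊.*-congˡ {constant (+ 2) ⋆ ((Tₖ ⋆ F) ⋆ G)} inverse))
                (𝕊.*-congˡ {(F ⋆ F) ⋆ G} marked-forest) ⟩
  (((Rₖ ⋆ G) ⋆ G) ⊕ ((constant (+ 2) ⋆ ((Tₖ ⋆ F) ⋆ G)) ⋆ 1ₛ)) ⊕ (((F ⋆ F) ⋆ G) ⋆ (Tₖ ⋆ L))
    ≈⟨ solve 4 (λ F L Tₖ Rₖ → let G = con 1ℤ :- F in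
                  ((Rₖ :* G) :* G :+ (con (+ 2) :* ((Tₖ :* F) :* G)) :* con 1ℤ) :+ ((F :* F) :* G) :* (Tₖ :* L)
               := ((Rₖ :* G) :* G :+ con (+ 2) :* ((Tₖ :* F) :* G)) :+ ((F :* F) :* Tₖ) :* (L :* G))
               (λ _ → refl) F L Tₖ Rₖ ⟩
  (((Rₖ ⋆ G) ⋆ G) ⊕ (constant (+ 2) ⋆ ((Tₖ ⋆ F) ⋆ G))) ⊕ (((F ⋆ F) ⋆ Tₖ) ⋆ (L ⋆ G))
    ≈⟨ 𝕊.+-congˡ {((Rₖ ⋆ G) ⋆ G) ⊕ (constant (+ 2) ⋆ ((Tₖ ⋆ F) ⋆ G))} (𝕊.*-congˡ {(F ⋆ F) ⋆ Tₖ} inverse) ⟩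
  (((Rₖ ⋆ G) ⋆ G) ⊕ (constant (+ 2) ⋆ ((Tₖ ⋆ F) ⋆ G))) ⊕ (((F ⋆ F) ⋆ Tₖ) ⋆ 1ₛ)
    ≈⟨ 𝕊.+-congˡ {((Rₖ ⋆ G) ⋆ G) ⊕ (constant (+ 2) ⋆ ((Tₖ ⋆ F) ⋆ G))} (𝕊.*-identityʳ ((F ⋆ F) ⋆ Tₖ)) ⟩
  (((Rₖ ⋆ G) ⋆ G) ⊕ (constant (+ 2) ⋆ ((Tₖ ⋆ F) ⋆ G))) ⊕ ((F ⋆ F) ⋆ Tₖ)
    ∎
  where
  open ≈ₛ-Reasoning
  G : Series
  G = 1ₛ ⊖ F

marked-tree-linear : ∀ {F L M Tₖ Rₖ} → L ⋆ (1ₛ ⊖ F) ≈ₛ 1ₛ → F ⋆ F ≈ₛ (F ⊖ X) ⋆ (1ₛ ⊖ F) →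
  M ⋆ (1ₛ ⊖ F) ≈ₛ Tₖ ⋆ L → Tₖ ≈ₛ Rₖ ⊕ ((Tₖ ⋆ (F ⋆ L)) ⊕ (F ⋆ ((Tₖ ⋆ L) ⊕ (F ⋆ M)))) →
  Tₖ ⋆ discriminantRoot F ≈ₛ Rₖ ⋆ (1ₛ ⊖ F)
marked-tree-linear {F} {L} {M} {Tₖ} {Rₖ} inverse quadratic marked-forest marked-tree =
  ⋆-cancelʳ-invertible {Tₖ ⋆ discriminantRoot F} {(Rₖ ⋆ G)} {G} {L} inverse (begin
    (Tₖ ⋆ discriminantRoot F) ⋆ G
      ≈⟨ solve 3 (λ X F Tₖ → let G = con 1ℤ :- F in
                    (Tₖ :* ((con 1ℤ :+ X) :- con (+ 4) :* F)) :* G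
                 := ((Tₖ :* G) :* G :- (con (+ 2) :* ((Tₖ :* F) :* G) :+ (F :* F) :* Tₖ))
                    :+ Tₖ :* (F :* F :- (F :- X) :* G))
                 (λ _ → refl) X F Tₖ ⟩
    ((Tₖ ⋆ G) ⋆ G ⊖ (twoTFG ⊕ ((F ⋆ F) ⋆ Tₖ))) ⊕ (Tₖ ⋆ (F ⋆ F ⊖ (F ⊖ X) ⋆ G))
      ≈⟨ 𝕊.+-cong (𝕊.+-congʳ {⊝ (twoTFG ⊕ ((F ⋆ F) ⋆ Tₖ))} cleared)
                  (𝕊.*-congˡ {Tₖ} (𝕊.+-congʳ {⊝ ((F ⊖ X) ⋆ G)} quadratic)) ⟩
    (((((Rₖ ⋆ G) ⋆ G) ⊕ twoTFG) ⊕ ((F ⋆ F) ⋆ Tₖ)) ⊖ (twoTFG ⊕ ((F ⋆ F) ⋆ Tₖ))) ⊕ (Tₖ ⋆ ((F ⊖ X) ⋆ G ⊖ (F ⊖ X) ⋆ G))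
      ≈⟨ solve 4 (λ X F Tₖ Rₖ → let G = con 1ℤ :- F ; twoTFG = con (+ 2) :* ((Tₖ :* F) :* G) in
                    ((((Rₖ :* G) :* G :+ twoTFG) :+ (F :* F) :* Tₖ) :- (twoTFG :+ (F :* F) :* Tₖ))
                    :+ Tₖ :* ((F :- X) :* G :- (F :- X) :* G)
                 := (Rₖ :* G) :* G)
                 (λ _ → refl) X F Tₖ Rₖ ⟩
    (Rₖ ⋆ G) ⋆ G
      ∎)
  where
  open ≈ₛ-Reasoning
  G twoTFG : Series
  G      = 1ₛ ⊖ F
  twoTFG = constant (+ 2) ⋆ ((Tₖ ⋆ F) ⋆ G)
  cleared : (Tₖ ⋆ G) ⋆ G ≈ₛ (((Rₖ ⋆ G) ⋆ G) ⊕ twoTFG) ⊕ ((F ⋆ F) ⋆ Tₖ)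
  cleared = marked-tree-cleared {F} {L} {M} {Tₖ} {Rₖ} inverse marked-forest marked-tree

closedForm : ∀ {F L M Tₖ Rₖ S} → F 0 ≡ 0ℤ → S 0 ≡ + 1 → S ⋆ S ≈ₛ P →
  L ≈ₛ 1ₛ ⊕ (F ⋆ L) → F ≈ₛ X ⊕ (F ⋆ (F ⋆ L)) →
  M ≈ₛ (Tₖ ⋆ L) ⊕ (F ⋆ M) → Tₖ ≈ₛ Rₖ ⊕ ((Tₖ ⋆ (F ⋆ L)) ⊕ (F ⋆ ((Tₖ ⋆ L) ⊕ (F ⋆ M)))) →
  ((+ 4) · S) ⋆ Tₖ ≈ₛ Rₖ ⋆ (threeMinusX ⊕ S)
closedForm {F} {L} {M} {Tₖ} {Rₖ} {S} F₀≡0 S₀≡1 S²≈P forest tree marked-forest marked-tree = begin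
  ((+ 4) · S) ⋆ Tₖ                  ≈⟨ 𝕊.*-congʳ {Tₖ} (constant-⋆ (+ 4) S) ⟨
  (constant (+ 4) ⋆ S) ⋆ Tₖ         ≈⟨ 𝕊.*-congʳ {Tₖ} (𝕊.*-congˡ {constant (+ 4)} S≈U) ⟩
  (constant (+ 4) ⋆ U) ⋆ Tₖ         ≈⟨ solve 2 (λ Tₖ U → (con (+ 4) :* U) :* Tₖ := con (+ 4) :* (Tₖ :* U))
                                              (λ _ → refl) Tₖ U ⟩
  constant (+ 4) ⋆ (Tₖ ⋆ U)         ≈⟨ 𝕊.*-congˡ {constant (+ 4)} linear ⟩
  constant (+ 4) ⋆ (Rₖ ⋆ (1ₛ ⊖ F))  ≈⟨ solve 3 (λ X F Rₖ → con (+ 4) :* (Rₖ :* (con 1ℤ :- F))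
                                                      := Rₖ :* ((con (+ 3) :- X) :+ ((con 1ℤ :+ X) :- con (+ 4) :* F)))
                                              (λ _ → refl) X F Rₖ ⟩
  Rₖ ⋆ ((constant (+ 3) ⊖ X) ⊕ U)   ≈⟨ 𝕊.*-congˡ {Rₖ} (𝕊.+-cong (𝕊.sym threeMinusX-expansion) (𝕊.sym S≈U)) ⟩
  Rₖ ⋆ (threeMinusX ⊕ S)            ∎
  where
  open ≈ₛ-Reasoning
  U : Series
  U = discriminantRoot F
  inverse : L ⋆ (1ₛ ⊖ F) ≈ₛ 1ₛ
  inverse = x≈y⊕Fx⇒x⋆[1⊖F]≈y {F} {L} {1ₛ} forest
  quadratic : F ⋆ F ≈ₛ (F ⊖ X) ⋆ (1ₛ ⊖ F)
  quadratic = tree-quadratic {F} {L} tree inverse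
  linear : Tₖ ⋆ U ≈ₛ Rₖ ⋆ (1ₛ ⊖ F)
  linear = marked-tree-linear {F} {L} {M} {Tₖ} {Rₖ} inverse quadratic
             (x≈y⊕Fx⇒x⋆[1⊖F]≈y {F} {M} {Tₖ ⋆ L} marked-forest) marked-tree
  S₀+U₀≡2 : (S ⊕ U) 0 ≡ + 2
  S₀+U₀≡2 = cong₂ _+_ S₀≡1 (cong (λ F₀ → (1ℤ + 0ℤ) + - (+ 4 * F₀)) F₀≡0)
  S≈U : S ≈ₛ U
  S≈U = squareRoot-unique {S} {U} (λ S₀+U₀≡0 → contradiction (trans (sym S₀+U₀≡2) S₀+U₀≡0) λ ())
          (𝕊.trans S²≈P (𝕊.sym (discriminantRoot-square {F} quadratic)))


-- Enumerations and their generating series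

private
  variable
    A B : Set

Enumerates : (A → Set) → List A → Set
Enumerates {A} Φ xs = Unique xs × (∀ (x : A) → x ∈ xs ⇔ Φ x)

sum-map-enumeration : ∀ {Φ : A → Set} {xs ys} (w : A → ℕ) →
  Enumerates Φ xs → Enumerates Φ ys → sum (map w xs) ≡ sum (map w ys)
sum-map-enumeration w (xs! , ∈xs⇔Φ) (ys! , ∈ys⇔Φ) =
  sum-↭ (↭.map⁺ w (∼bag⇒↭ (unique∧set⇒bag xs! ys! λ {x} →
    mk⇔ (Equivalence.from (∈ys⇔Φ x) ∘′ Equivalence.to (∈xs⇔Φ x))
        (Equivalence.from (∈xs⇔Φ x) ∘′ Equivalence.to (∈ys⇔Φ x)))))

Enumerates-++ : ∀ {Φ Ψ : A → Set} {xs ys} → (∀ {x} → Φ x → Ψ x → ⊥) →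
  Enumerates Φ xs → Enumerates Ψ ys → Enumerates (λ x → Φ x ⊎ Ψ x) (xs ++ ys)
Enumerates-++ {xs = xs} Φ∩Ψ=∅ (xs! , ∈xs⇔Φ) (ys! , ∈ys⇔Ψ) =
  Unique.++⁺ xs! ys! (λ (∈xs , ∈ys) → Φ∩Ψ=∅ (to (∈xs⇔Φ _) ∈xs) (to (∈ys⇔Ψ _) ∈ys)) ,
  λ x → mk⇔ (λ ∈xs++ys → [ inj₁ ∘′ to (∈xs⇔Φ x) , inj₂ ∘′ to (∈ys⇔Ψ x) ] (∈-++⁻ xs ∈xs++ys))
            [ ∈-++⁺ˡ ∘′ from (∈xs⇔Φ x) , ∈-++⁺ʳ xs ∘′ from (∈ys⇔Ψ x) ]
  where open Equivalence

Enumerates-map : ∀ {Φ : A → Set} {Ψ : B → Set} {f xs} → Injective _≡_ _≡_ f →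
  (∀ x → Φ x → Ψ (f x)) → (∀ y → Ψ y → ∃[ x ] Φ x × f x ≡ y) →
  Enumerates Φ xs → Enumerates Ψ (map f xs)
Enumerates-map {Ψ = Ψ} {f = f} f-injective Φ⇒Ψf Ψ⇒Φf (xs! , ∈xs⇔Φ) =
  Unique.map⁺ f-injective xs! ,
  λ y → mk⇔ (λ y∈ → let (x , x∈ , y≡fx) = ∈-map⁻ f y∈ in subst Ψ (sym y≡fx) (Φ⇒Ψf x (to (∈xs⇔Φ x) x∈)))
            (λ Ψy → let (x , Φx , fx≡y) = Ψ⇒Φf y Ψy in subst (_∈ _) fx≡y (∈-map⁺ f (from (∈xs⇔Φ x) Φx)))
  where open Equivalence

Enumerates-⇔ : ∀ {Φ Ψ : A → Set} {xs} → (∀ x → Φ x ⇔ Ψ x) → Enumerates Φ xs → Enumerates Ψ xs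
Enumerates-⇔ Φ⇔Ψ (xs! , ∈xs⇔Φ) = xs! , λ x → ⇔.trans (∈xs⇔Φ x) (Φ⇔Ψ x)

Enumerates-cartesianProduct : ∀ {Φ : A → Set} {Ψ : B → Set} {xs ys} →
  Enumerates Φ xs → Enumerates Ψ ys →
  Enumerates (λ p → Φ (proj₁ p) × Ψ (proj₂ p)) (cartesianProduct xs ys)
Enumerates-cartesianProduct {xs = xs} {ys} (xs! , ∈xs⇔Φ) (ys! , ∈ys⇔Ψ) =
  Unique.cartesianProduct⁺ xs! ys! ,
  λ (a , b) → mk⇔ (λ ab∈ → let (a∈ , b∈) = ∈-cartesianProduct⁻ xs ys ab∈
                            in to (∈xs⇔Φ a) a∈ , to (∈ys⇔Ψ b) b∈)
                  (λ (Φa , Ψb) → ∈-cartesianProduct⁺ (from (∈xs⇔Φ a) Φa) (from (∈ys⇔Ψ b) Ψb))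
  where open Equivalence

_⊗_ : (ℕ → List A) → (ℕ → List B) → ℕ → List (A × B)
(e ⊗ e′) zero    = cartesianProduct (e 0) (e′ 0)
(e ⊗ e′) (suc n) = cartesianProduct (e 0) (e′ (suc n)) ++ ((λ i → e (suc i)) ⊗ e′) n

Enumerates-⊗ : ∀ {Φ : ℕ → A → Set} {Ψ : ℕ → B → Set} {e e′} n →
  (∀ {i i′ a} → Φ i a → Φ i′ a → i ≡ i′) →
  (∀ i j → i ℕ.+ j ≡ n → Enumerates (Φ i) (e i) × Enumerates (Ψ j) (e′ j)) →
  Enumerates (λ p → ∃[ i ] ∃[ j ] i ℕ.+ j ≡ n × Φ i (proj₁ p) × Ψ j (proj₂ p)) ((e ⊗ e′) n)
Enumerates-⊗ zero Φ-functional enumerations =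
  Enumerates-⇔ (λ _ → mk⇔ (λ (Φa , Ψb) → 0 , 0 , refl , Φa , Ψb)
                          (λ { (0 , 0 , _ , Φa , Ψb) → Φa , Ψb }))
               (Enumerates-cartesianProduct (proj₁ (enumerations 0 0 refl)) (proj₂ (enumerations 0 0 refl)))
Enumerates-⊗ {Φ = Φ} {Ψ} (suc n) Φ-functional enumerations =
  Enumerates-⇔ (λ _ → mk⇔ [ (λ (Φa , Ψb) → 0 , suc n , refl , Φa , Ψb)
                          , (λ (i , j , i+j≡n , Φa , Ψb) → suc i , j , cong suc i+j≡n , Φa , Ψb) ]
                          λ { (zero , j , refl , Φa , Ψb) → inj₁ (Φa , Ψb)
                            ; (suc i , j , i+j≡n , Φa , Ψb) → inj₂ (i , j , ℕₚ.suc-injective i+j≡n , Φa , Ψb) })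
    (Enumerates-++ (λ (Φ₀a , _) (_ , _ , _ , Φₛa , _) → ℕₚ.0≢1+n (Φ-functional Φ₀a Φₛa))
      (Enumerates-cartesianProduct (proj₁ (enumerations 0 (suc n) refl))
                                   (proj₂ (enumerations 0 (suc n) refl)))
      (Enumerates-⊗ {Φ = λ i → Φ (suc i)} {Ψ} n (λ Φa Φa′ → ℕₚ.suc-injective (Φ-functional Φa Φa′))
                    (λ i j i+j≡n → enumerations (suc i) j (cong suc i+j≡n))))

Enumerates-⊗-sized : ∀ {σ : A → ℕ} {τ : B → ℕ} {e e′} →
  (∀ i → Enumerates (λ a → σ a ≡ i) (e i)) → (∀ j → Enumerates (λ b → τ b ≡ j) (e′ j)) →
  ∀ n → Enumerates (λ p → σ (proj₁ p) ℕ.+ τ (proj₂ p) ≡ n) ((e ⊗ e′) n)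
Enumerates-⊗-sized e-enum e′-enum n =
  Enumerates-⇔ (λ _ → mk⇔ (λ { (i , j , i+j≡n , refl , refl) → i+j≡n })
                          (λ σa+τb≡n → _ , _ , σa+τb≡n , refl , refl))
               (Enumerates-⊗ n (λ σa≡i σa≡i′ → trans (sym σa≡i) σa≡i′) (λ i j _ → e-enum i , e′-enum j))

sum-map-++ : ∀ (w : A → ℕ) xs ys → sum (map w (xs ++ ys)) ≡ sum (map w xs) ℕ.+ sum (map w ys)
sum-map-++ w xs ys = trans (cong sum (map-++ w xs ys)) (sum-++ (map w xs) (map w ys))

sum-map-+ : ∀ (u v : A → ℕ) xs → sum (map (λ x → u x ℕ.+ v x) xs) ≡ sum (map u xs) ℕ.+ sum (map v xs)
sum-map-+ u v []       = refl
sum-map-+ u v (x ∷ xs) =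
  trans (cong (u x ℕ.+ v x ℕ.+_) (sum-map-+ u v xs)) (ℕ+.interchange (u x) (v x) _ _)

sum-map-*ˡ : ∀ c (u : A → ℕ) xs → sum (map (λ x → c ℕ.* u x) xs) ≡ c ℕ.* sum (map u xs)
sum-map-*ˡ c u []       = sym (ℕₚ.*-zeroʳ c)
sum-map-*ˡ c u (x ∷ xs) =
  trans (cong (c ℕ.* u x ℕ.+_) (sum-map-*ˡ c u xs)) (sym (ℕₚ.*-distribˡ-+ c (u x) _))

sum-map-cartesianProduct-* : ∀ (u : A → ℕ) (v : B → ℕ) xs ys →
  sum (map (λ p → u (proj₁ p) ℕ.* v (proj₂ p)) (cartesianProduct xs ys)) ≡ sum (map u xs) ℕ.* sum (map v ys)
sum-map-cartesianProduct-* u v []       ys = refl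
sum-map-cartesianProduct-* u v (x ∷ xs) ys = begin
  sum (map w (map (x ,_) ys ++ cartesianProduct xs ys))
    ≡⟨ sum-map-++ w (map (x ,_) ys) (cartesianProduct xs ys) ⟩
  sum (map w (map (x ,_) ys)) ℕ.+ sum (map w (cartesianProduct xs ys))
    ≡⟨ cong₂ ℕ._+_ (trans (sym (cong sum (map-∘ ys))) (sum-map-*ˡ (u x) v ys))
                   (sum-map-cartesianProduct-* u v xs ys) ⟩
  u x ℕ.* sum (map v ys) ℕ.+ sum (map u xs) ℕ.* sum (map v ys)
    ≡⟨ ℕₚ.*-distribʳ-+ (sum (map v ys)) (u x) _ ⟨
  (u x ℕ.+ sum (map u xs)) ℕ.* sum (map v ys)
    ∎
  where
  open ≡-Reasoning
  w : _ → ℕ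
  w p = u (proj₁ p) ℕ.* v (proj₂ p)

gf : (A → ℕ) → (ℕ → List A) → Series
gf w e n = + sum (map w (e n))

count : (ℕ → List A) → Series
count = gf (const 1)

gf-+ : ∀ (u v : A → ℕ) e → gf (λ x → u x ℕ.+ v x) e ≈ₛ gf u e ⊕ gf v e
gf-+ u v e n = trans (cong +_ (sum-map-+ u v (e n))) (ℤ.pos-+ (sum (map u (e n))) _)

gf-⊗-* : ∀ (u : A → ℕ) (v : B → ℕ) e e′ →
  gf (λ p → u (proj₁ p) ℕ.* v (proj₂ p)) (e ⊗ e′) ≈ₛ gf u e ⋆ gf v e′
gf-⊗-* u v e e′ zero    =
  trans (cong +_ (sum-map-cartesianProduct-* u v (e 0) (e′ 0))) (ℤ.pos-* (sum (map u (e 0))) _)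
gf-⊗-* u v e e′ (suc n) =
  trans (cong +_ (sum-map-++ _ (cartesianProduct (e 0) (e′ (suc n))) _))
  (trans (ℤ.pos-+ (sum (map _ (cartesianProduct (e 0) (e′ (suc n))))) _)
         (cong₂ _+_ (trans (cong +_ (sum-map-cartesianProduct-* u v (e 0) (e′ (suc n))))
                           (ℤ.pos-* (sum (map u (e 0))) _))
                    (gf-⊗-* u v (λ i → e (suc i)) e′ n)))

gf-⊗-+ : ∀ (u : A → ℕ) (v : B → ℕ) e e′ →
  gf (λ p → u (proj₁ p) ℕ.+ v (proj₂ p)) (e ⊗ e′) ≈ₛ (gf u e ⋆ count e′) ⊕ (count e ⋆ gf v e′)
gf-⊗-+ u v e e′ n = begin
  gf (λ p → u (proj₁ p) ℕ.+ v (proj₂ p)) (e ⊗ e′) n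
    ≡⟨ cong (λ xs → + sum xs) (map-cong (λ p → cong₂ ℕ._+_ (sym (ℕₚ.*-identityʳ (u (proj₁ p))))
                                                          (sym (ℕₚ.*-identityˡ (v (proj₂ p)))))
                                        ((e ⊗ e′) n)) ⟩
  gf (λ p → u (proj₁ p) ℕ.* 1 ℕ.+ 1 ℕ.* v (proj₂ p)) (e ⊗ e′) n
    ≡⟨ gf-+ (λ p → u (proj₁ p) ℕ.* 1) (λ p → 1 ℕ.* v (proj₂ p)) (e ⊗ e′) n ⟩
  gf (λ p → u (proj₁ p) ℕ.* 1) (e ⊗ e′) n + gf (λ p → 1 ℕ.* v (proj₂ p)) (e ⊗ e′) n
    ≡⟨ cong₂ _+_ (gf-⊗-* u (const 1) e e′ n) (gf-⊗-* (const 1) v e e′ n) ⟩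
  (gf u e ⋆ count e′) n + (count e ⋆ gf v e′) n
    ∎
  where open ≡-Reasoning


-- Decomposing Schröder trees at the root

leaves≡suc : ∀ t → ∃[ i ] leaves t ≡ suc i
leaves≡suc leaf          = 0 , refl
leaves≡suc (node a b cs) =
  let (i , leaves-a≡1+i) = leaves≡suc a
  in i ℕ.+ (leaves b ℕ.+ leavesL cs) , cong (ℕ._+ (leaves b ℕ.+ leavesL cs)) leaves-a≡1+i

leaves≢0 : ∀ t → leaves t ≢ 0
leaves≢0 t leaves≡0 = ℕₚ.0≢1+n (trans (sym leaves≡0) (proj₂ (leaves≡suc t)))

childSubCount : ℕ → Tree → ℕ
childSubCount k leaf          = 0
childSubCount k (node a b cs) = subCount k a ℕ.+ (subCount k b ℕ.+ subCountL k cs)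

subCount-root : ∀ k t → subCount k t ≡ ind (vertices t) k ℕ.+ childSubCount k t
subCount-root k leaf          = sym (ℕₚ.+-identityʳ _)
subCount-root k (node a b cs) = refl

module Decomposition (enum : ℕ → List Tree)
                     (enumerates : ∀ n → Enumerates (λ t → leaves t ≡ n) (enum n)) where

  enum-0≡[] : enum 0 ≡ []
  enum-0≡[] with enum 0 | enumerates 0
  ... | []    | _        = refl
  ... | t ∷ _ | _ , ∈⇔ = contradiction (Equivalence.to (∈⇔ t) (here refl)) (leaves≢0 t)

  gf-enum-0≡0 : ∀ w → gf w enum 0 ≡ 0ℤ
  gf-enum-0≡0 w = cong (λ ts → + sum (map w ts)) enum-0≡[]

  enum⁺ : ℕ → List Tree
  enum⁺ i = enum (suc i)

  HeadAndTail : ℕ → Tree × List Tree → Set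
  HeadAndTail n p = ∃[ i ] ∃[ j ] i ℕ.+ j ≡ n × leaves (proj₁ p) ≡ suc i × leavesL (proj₂ p) ≡ j

  Enumerates-enum⁺⊗ : ∀ {e} n → (∀ j → j ≤ n → Enumerates (λ cs → leavesL cs ≡ j) (e j)) →
                      Enumerates (HeadAndTail n) ((enum⁺ ⊗ e) n)
  Enumerates-enum⁺⊗ n e-enum =
    Enumerates-⊗ n (λ c≡1+i c≡1+i′ → ℕₚ.suc-injective (trans (sym c≡1+i) c≡1+i′))
                 (λ i j i+j≡n → enumerates (suc i) , e-enum j (subst (j ≤_) i+j≡n (ℕₚ.m≤n+m j i)))

  -- The first argument is fuel: any fuel above n lists the forests with n leaves.
  forestsWithin : ℕ → ℕ → List (List Tree)
  forestsWithin zero    _       = []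
  forestsWithin (suc f) zero    = [] ∷ []
  forestsWithin (suc f) (suc n) = map (uncurry _∷_) ((enum⁺ ⊗ forestsWithin f) n)

  Enumerates-forestsWithin : ∀ f n → n < f → Enumerates (λ cs → leavesL cs ≡ n) (forestsWithin f n)
  Enumerates-forestsWithin (suc f) zero    _ =
    ([] AllPairs.∷ AllPairs.[]) ,
    λ { [] → mk⇔ (λ _ → refl) (λ _ → here refl)
      ; (c ∷ cs) → mk⇔ (λ { (here ()) ; (there ()) })
                       (λ c∷cs≡0 → contradiction (ℕₚ.m+n≡0⇒m≡0 (leaves c) c∷cs≡0) (leaves≢0 c)) }
  Enumerates-forestsWithin (suc f) (suc n) (ℕ.s≤s n<f) =
    Enumerates-map (λ { {_ , _} {_ , _} refl → refl }) join split
      (Enumerates-enum⁺⊗ n λ j j≤n → Enumerates-forestsWithin f j (ℕₚ.≤-<-trans j≤n n<f))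
    where
    join : ∀ p → HeadAndTail n p → leavesL (uncurry _∷_ p) ≡ suc n
    join _ (i , j , i+j≡n , c≡1+i , cs≡j) = trans (cong₂ ℕ._+_ c≡1+i cs≡j) (cong suc i+j≡n)
    split : ∀ cs → leavesL cs ≡ suc n → ∃[ p ] HeadAndTail n p × uncurry _∷_ p ≡ cs
    split []       ()
    split (c ∷ cs) c∷cs≡1+n with leaves≡suc c
    ... | i , c≡1+i = (c , cs) , (i , leavesL cs , i+cs≡n , c≡1+i , refl) , refl
      where
      i+cs≡n : i ℕ.+ leavesL cs ≡ n
      i+cs≡n = ℕₚ.suc-injective (trans (sym (cong (ℕ._+ leavesL cs) c≡1+i)) c∷cs≡1+n)

  forests : ℕ → List (List Tree)
  forests n = forestsWithin (suc n) n

  Enumerates-forests : ∀ n → Enumerates (λ cs → leavesL cs ≡ n) (forests n)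
  Enumerates-forests n = Enumerates-forestsWithin (suc n) n ℕₚ.≤-refl

  gf-forests-suc : ∀ (w : List Tree → ℕ) n →
                   gf w forests (suc n) ≡ gf (w ∘′ uncurry _∷_) (enum⁺ ⊗ forests) n
  gf-forests-suc w n = cong +_ (trans (cong sum (sym (map-∘ ((enum⁺ ⊗ forestsWithin (suc n)) n))))
    (sum-map-enumeration (w ∘′ uncurry _∷_)
      (Enumerates-enum⁺⊗ n λ j j≤n → Enumerates-forestsWithin (suc n) j (ℕ.s≤s j≤n))
      (Enumerates-enum⁺⊗ n λ j _ → Enumerates-forests j)))

  subtrees : ℕ → List (Tree × (Tree × List Tree))
  subtrees = enum ⊗ (enum ⊗ forests)

  toNode : Tree × (Tree × List Tree) → Tree
  toNode (a , b , cs) = node a b cs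

  leafList : ℕ → List Tree
  leafList 1 = leaf ∷ []
  leafList _ = []

  Enumerates-leafList : ∀ n → Enumerates (λ t → t ≡ leaf × n ≡ 1) (leafList n)
  Enumerates-leafList 0             = AllPairs.[] , λ _ → mk⇔ (λ ()) λ ()
  Enumerates-leafList 1             = ([] AllPairs.∷ AllPairs.[]) ,
    λ _ → mk⇔ (λ { (here refl) → refl , refl }) λ { (refl , _) → here refl }
  Enumerates-leafList (suc (suc n)) = AllPairs.[] , λ _ → mk⇔ (λ ()) λ ()

  Enumerates-trees : ∀ n → Enumerates (λ t → leaves t ≡ n) (leafList n ++ map toNode (subtrees n))
  Enumerates-trees n =
    Enumerates-⇔ (λ { leaf → mk⇔ [ (λ (_ , 1≡n) → sym 1≡n) , proj₁ ] λ 1≡n → inj₁ (refl , sym 1≡n)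
                    ; (node a b cs) → mk⇔ [ (λ ()) ∘′ proj₁ , proj₁ ] λ t≡n → inj₂ (t≡n , λ ()) })
      (Enumerates-++ (λ (t≡leaf , _) (_ , t≢leaf) → t≢leaf t≡leaf)
        (Enumerates-leafList n)
        (Enumerates-map {Ψ = λ t → leaves t ≡ n × t ≢ leaf}
          (λ { {_ , _ , _} {_ , _ , _} refl → refl })
          (λ _ t≡n → t≡n , λ ())
          (λ { leaf (_ , leaf≢leaf) → contradiction refl leaf≢leaf
             ; (node a b cs) (t≡n , _) → (a , b , cs) , t≡n , refl })
          (Enumerates-⊗-sized enumerates (Enumerates-⊗-sized enumerates Enumerates-forests) n)))

  gf-trees : ∀ (w : Tree → ℕ) → gf w enum ≈ₛ gf w leafList ⊕ gf (w ∘′ toNode) subtrees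
  gf-trees w n = begin
    + sum (map w (enum n))
      ≡⟨ cong +_ (sum-map-enumeration w (enumerates n) (Enumerates-trees n)) ⟩
    + sum (map w (leafList n ++ map toNode (subtrees n)))
      ≡⟨ cong +_ (sum-map-++ w (leafList n) (map toNode (subtrees n))) ⟩
    + (sum (map w (leafList n)) ℕ.+ sum (map w (map toNode (subtrees n))))
      ≡⟨ ℤ.pos-+ (sum (map w (leafList n))) _ ⟩
    gf w leafList n + + sum (map w (map toNode (subtrees n)))
      ≡⟨ cong (λ ws → gf w leafList n + + sum ws) (map-∘ (subtrees n)) ⟨
    gf w leafList n + gf (w ∘′ toNode) subtrees n
      ∎
    where open ≡-Reasoning

  F L : Series
  F = count enum
  L = count forests

  F₀≡0 : F 0 ≡ 0ℤ
  F₀≡0 = gf-enum-0≡0 (const 1)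

  forest-equation : L ≈ₛ 1ₛ ⊕ (F ⋆ L)
  forest-equation zero    = cong (λ F₀ → 1ℤ + F₀ * + 1) (sym F₀≡0)
  forest-equation (suc n) = begin
    L (suc n)                         ≡⟨ gf-forests-suc (const 1) n ⟩
    gf (const 1) (enum⁺ ⊗ forests) n  ≡⟨ gf-⊗-* (const 1) (const 1) enum⁺ forests n ⟩
    (count enum⁺ ⋆ L) n               ≡⟨ ⋆-shiftˡ F L n F₀≡0 ⟨
    (F ⋆ L) (suc n)                   ≡⟨ ℤ.+-identityˡ _ ⟨
    0ℤ + (F ⋆ L) (suc n)              ∎
    where open ≡-Reasoning

  count-subtrees : count subtrees ≈ₛ F ⋆ (F ⋆ L)
  count-subtrees n = trans (gf-⊗-* (const 1) (const 1) enum (enum ⊗ forests) n)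
                           (⋆-cong {F} (λ _ → refl) (gf-⊗-* (const 1) (const 1) enum forests) n)

  tree-equation : F ≈ₛ X ⊕ (F ⋆ (F ⋆ L))
  tree-equation n = trans (gf-trees (const 1) n) (cong₂ _+_ (count-leafList n) (count-subtrees n))
    where
    count-leafList : count leafList ≈ₛ X
    count-leafList 0             = refl
    count-leafList 1             = refl
    count-leafList (suc (suc n)) = refl

  module Marked (k : ℕ) where

    Tₖ Rₖ M : Series
    Tₖ = gf (subCount k) enum
    Rₖ = gf (λ t → ind (vertices t) k) enum
    M  = gf (subCountL k) forests

    marked-forest-equation : M ≈ₛ (Tₖ ⋆ L) ⊕ (F ⋆ M)
    marked-forest-equation zero    =
      cong₂ (λ T₀ F₀ → T₀ * + 1 + F₀ * + 0) (sym (gf-enum-0≡0 (subCount k))) (sym F₀≡0)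
    marked-forest-equation (suc n) = begin
      M (suc n)
        ≡⟨ gf-forests-suc (subCountL k) n ⟩
      gf (λ p → subCount k (proj₁ p) ℕ.+ subCountL k (proj₂ p)) (enum⁺ ⊗ forests) n
        ≡⟨ gf-⊗-+ (subCount k) (subCountL k) enum⁺ forests n ⟩
      ((λ i → Tₖ (suc i)) ⋆ L) n + ((λ i → F (suc i)) ⋆ M) n
        ≡⟨ cong₂ _+_ (⋆-shiftˡ Tₖ L n (gf-enum-0≡0 (subCount k))) (⋆-shiftˡ F M n F₀≡0) ⟨
      (Tₖ ⋆ L) (suc n) + (F ⋆ M) (suc n)
        ∎
      where open ≡-Reasoning

    marked-tree-equation : Tₖ ≈ₛ Rₖ ⊕ ((Tₖ ⋆ (F ⋆ L)) ⊕ (F ⋆ ((Tₖ ⋆ L) ⊕ (F ⋆ M))))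
    marked-tree-equation n = begin
      Tₖ n
        ≡⟨ cong (λ ws → + sum ws) (map-cong (subCount-root k) (enum n)) ⟩
      gf (λ t → ind (vertices t) k ℕ.+ childSubCount k t) enum n
        ≡⟨ gf-+ (λ t → ind (vertices t) k) (childSubCount k) enum n ⟩
      Rₖ n + gf (childSubCount k) enum n
        ≡⟨ cong (_+_ (Rₖ n)) (gf-trees (childSubCount k) n) ⟩
      Rₖ n + (gf (childSubCount k) leafList n + gf (childSubCount k ∘′ toNode) subtrees n)
        ≡⟨ cong (λ z → Rₖ n + (z + gf (childSubCount k ∘′ toNode) subtrees n)) (childSubCount-leafList n) ⟩
      Rₖ n + (0ℤ + gf (childSubCount k ∘′ toNode) subtrees n)
        ≡⟨ cong (_+_ (Rₖ n)) (ℤ.+-identityˡ (gf (childSubCount k ∘′ toNode) subtrees n)) ⟩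
      Rₖ n + gf (childSubCount k ∘′ toNode) subtrees n
        ≡⟨ cong (_+_ (Rₖ n)) (gf-⊗-+ (subCount k) forestWeight enum (enum ⊗ forests) n) ⟩
      Rₖ n + ((Tₖ ⋆ count (enum ⊗ forests)) ⊕ (F ⋆ gf forestWeight (enum ⊗ forests))) n
        ≡⟨ cong (_+_ (Rₖ n)) (cong₂ _+_
             (⋆-cong {Tₖ} (λ _ → refl) (gf-⊗-* (const 1) (const 1) enum forests) n)
             (⋆-cong {F} (λ _ → refl) (gf-⊗-+ (subCount k) (subCountL k) enum forests) n)) ⟩
      Rₖ n + ((Tₖ ⋆ (F ⋆ L)) ⊕ (F ⋆ ((Tₖ ⋆ L) ⊕ (F ⋆ M)))) n
        ∎
      where
      open ≡-Reasoning
      forestWeight : Tree × List Tree → ℕ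
      forestWeight (b , cs) = subCount k b ℕ.+ subCountL k cs
      childSubCount-leafList : ∀ n → gf (childSubCount k) leafList n ≡ 0ℤ
      childSubCount-leafList 0             = refl
      childSubCount-leafList 1             = refl
      childSubCount-leafList (suc (suc n)) = refl

mainTheorem11 : (enum : ℕ → List Tree)
    → (∀ n → Unique (enum n))
    → (∀ n t → (t ∈ enum n) ⇔ (leaves t ≡ n))
    → (k : ℕ) → 1 ≤ k
    → (S : Series) → S 0 ≡ + 1 → (∀ n → (S ⋆ S) n ≡ P n)
    → ∀ n → (((+ 4) · S) ⋆ T enum k) n ≡ (R enum k ⋆ (threeMinusX ⊕ S)) n
mainTheorem11 enum unique membership k _ S S₀≡1 S²≡P =
  closedForm {F} {L} {M} {Tₖ} {Rₖ} {S} F₀≡0 S₀≡1 S²≡P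
              forest-equation tree-equation marked-forest-equation marked-tree-equation
  where
  open Decomposition enum (λ n → unique n , membership n)
  open Marked k
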